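{- Order the possible parts of an overpartition into odd parts by $1<\overline{1}<3<\overline{3}<5<\overline{5}<\cdots$. For an overpartition $\pi$ into odd parts, let $\widetilde{\mathrm{omoex}}(\pi)=\overline{2k-1}$, where $k$ is the smallest positive integer such that $\overline{2k-1}$ is not a part of $\pi$. Let $\widetilde{m}_o(n)$ denote the number of overpartitions $\pi$ of $n$ into odd parts such that every element of $\{1,\overline{1},3,\overline{3},\dots\}$ smaller than $\widetilde{\mathrm{omoex}}(\pi)$ in this ordering occurs as a part of $\pi$. That is, if $\widetilde{\mathrm{omoex}}(\pi)=\overline{2k-1}$, then $1,3,\dots,2k-1$ occur as non-overlined parts and $\overline{1},\overline{3},\dots,\overline{2k-3}$ occur as overlined parts. Let $\widetilde{M}_o(q)=\sum_{n\ge0}\widetilde{m}_o(n)q^n$. Then $$\widetilde{M}_o(q)=q\,\overline{P}_o(q)\,F_1(-q),$$ where $\overline{P}_o(q)=\dfrac{(-q;q^2)_\infty}{(q;q^2)_\infty}$ and $F_1(q)=\displaystyle\sum_{n=0}^{\infty}\frac{q^{2n^2+2n}}{(q;q^2)_{n+1}}$ is Ramanujan's fifth order mock theta function.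
   Context: For $|q|<1$, $(a;q)_L=\prod_{k=0}^{L-1}(1-aq^k)$ and $(a;q)_\infty=\lim_{L\to\infty}(a;q)_L$. An overpartition of $n$ is a partition of $n$ in which the first occurrence of each distinct part size may be overlined. An overpartition into odd parts has all parts odd. The empty overpartition is the unique overpartition of $0$. The identity is an identity of formal power series in $q$. -}

module Defs where

open import Data.Nat using (ℕ; zero; suc; _∸_; _≤_) renaming (_+_ to _+ℕ_; _*_ to _*ℕ_)
open import Data.Nat.Divisibility using (_∣?_)
open import Data.Integer using (ℤ; +_; -_; _+_; _*_)
open import Data.Bool using (Bool; true; false; if_then_else_; _∧_; T)
open import Data.Product using (Σ; _×_; _,_; proj₁; proj₂)
open import Data.Vec using (Vec; []; _∷_)
open import Relation.Nullary.Decidable using (⌊_⌋)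
open import Relation.Binary.PropositionalEquality using (_≡_)

-- An overpartition of n into odd parts is represented by a vector of
-- length n whose i-th entry (i = 0,1,...,n-1) is (m , b) where
--   m = number of NON-overlined copies of the part 2i+1,
--   b = whether the overlined part  \overline{2i+1}  occurs (at most once).
-- Every part of an overpartition of n is ≤ n, hence of the form 2i+1 with
-- i < n, so length n suffices; this representation is canonical (one
-- vector per overpartition).

Entry : Set
Entry = ℕ × Bool

bit : Bool → ℕ
bit true  = 1
bit false = 0

weightFrom : ∀ {k} → ℕ → Vec Entry k → ℕ
weightFrom s [] = 0
weightFrom s ((m , b) ∷ v) =
  (m +ℕ bit b) *ℕ (2 *ℕ s +ℕ 1) +ℕ weightFrom (suc s) v

OddOverpartition : ℕ → Set
OddOverpartition n = Σ (Vec Entry n) (λ v → weightFrom 0 v ≡ n)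

multNon : ∀ {k} → Vec Entry k → ℕ → ℕ
multNon [] i = 0
multNon ((m , b) ∷ v) zero = m
multNon ((m , b) ∷ v) (suc i) = multNon v i

-- omoexIdx v = k-1, where k is the smallest positive integer such that the
-- overlined part \overline{2k-1} does not occur (i.e. omoex~ = \overline{2k-1}).
omoexIdx : ∀ {k} → Vec Entry k → ℕ
omoexIdx [] = 0
omoexIdx ((m , true) ∷ v) = suc (omoexIdx v)
omoexIdx ((m , false) ∷ v) = 0

allBelow : ℕ → (ℕ → Bool) → Bool
allBelow zero p = true
allBelow (suc N) p = allBelow N p ∧ p N

isPos : ℕ → Bool
isPos zero = false
isPos (suc _) = true

-- Every element of {1, \bar1, 3, \bar3, ...} smaller than omoex~(π) = \overline{2k-1}
-- occurs: the overlined parts \bar1,...,\overline{2k-3} occur by definition of k,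
-- so the condition is that the non-overlined parts 1,3,...,2k-1 occur,
-- i.e. multNon v i ≥ 1 for all i ≤ k-1.
omoCond : ∀ {k} → Vec Entry k → Bool
omoCond v = allBelow (suc (omoexIdx v)) (λ i → isPos (multNon v i))

MoTilde : ℕ → Set
MoTilde n = Σ (OddOverpartition n) (λ π → T (omoCond (proj₁ π)))

Series : Set
Series = ℕ → ℤ

sumBelow : ℕ → (ℕ → ℤ) → ℤ
sumBelow zero f = + 0
sumBelow (suc N) f = sumBelow N f + f N

_⊗_ : Series → Series → Series
(f ⊗ g) n = sumBelow (suc n) (λ i → f i * g (n ∸ i))

_⊕_ : Series → Series → Series
(f ⊕ g) n = f n + g n

oneS : Series
oneS zero = + 1
oneS (suc _) = + 0

mono : ℕ → Series
mono zero = oneS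
mono (suc a) zero = + 0
mono (suc a) (suc n) = mono a n

-- 1 / (1 - q^(2k+1)) = sum_j q^((2k+1) j)
geomOdd : ℕ → Series
geomOdd k n = if ⌊ (2 *ℕ k +ℕ 1) ∣? n ⌋ then + 1 else + 0

prodBelow : ℕ → (ℕ → Series) → Series
prodBelow zero f = oneS
prodBelow (suc N) f = prodBelow N f ⊗ f N

negArg : Series → Series
negArg f n = if ⌊ 2 ∣? n ⌋ then f n else - f n

shiftS : Series → Series
shiftS f zero = + 0
shiftS f (suc n) = f n

-- \bar P_o(q) = (-q;q^2)_∞/(q;q^2)_∞ = ∏_{k≥0} (1+q^{2k+1})/(1-q^{2k+1}).
-- The coefficient of q^n only depends on the factors with 2k+1 ≤ n
-- (the others are ≡ 1 mod q^{n+1}), so it equals the coefficient of q^n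
-- in the product of the first n+1 factors.
PoBar : Series
PoBar n = prodBelow (suc n) (λ k → (oneS ⊕ mono (2 *ℕ k +ℕ 1)) ⊗ geomOdd k) n

invPochOdd : ℕ → Series
invPochOdd m = prodBelow (suc m) geomOdd

-- F_1(q) = Σ_{m≥0} q^{2m^2+2m}/(q;q^2)_{m+1}; the m-th term is O(q^{2m^2+2m})
-- and 2m^2+2m > n for m > n, so only the terms m ≤ n contribute to q^n.
F1 : Series
F1 n = sumBelow (suc n)
  (λ m → (mono (2 *ℕ m *ℕ m +ℕ 2 *ℕ m) ⊗ invPochOdd m) n)

rhsSeries : Series
rhsSeries = shiftS (PoBar ⊗ negArg F1)

-- Record an overpartition into odd parts by its entries (m_j , b_j) for the part 2j+1; entry j then
-- contributes the factor (1 + q^(2j+1)) / (1 - q^(2j+1)) of P̄_o.  The condition on omoex says that for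
-- some k the entries j < k are (≥ 1 , overlined) and entry k is (≥ 1 , not overlined), which has
-- generating function q^(2k²+2k+1) ∏_{j ≤ k} 1/(1 - q^(2j+1)) ∏_{j > k} (1 + q^(2j+1))/(1 - q^(2j+1)).
-- Since 1/(1 - q^(2j+1)) = (1 + q^(2j+1))/(1 - q^(2j+1)) · 1/(1 + q^(2j+1)), this equals
-- q · P̄_o(q) · q^(2k²+2k) / (-q;q²)_{k+1}, the k-th term of q P̄_o(q) F₁(-q) (2k²+2k is even).

module Submission where

open import Defs
open import Data.Nat as ℕ using (ℕ; zero; suc; _∸_; _≤_; _<_; z≤n; s≤s) renaming (_+_ to _+ℕ_; _*_ to _*ℕ_)
import Data.Nat.Properties as ℕ
import Data.Nat.Tactic.RingSolver as ℕ-Solver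
open import Data.Nat.Divisibility using (_∣_; _∣?_; divides; ∣⇒≤; ∣-refl; ∣m+n∣m⇒∣n; ∣m∣n⇒∣m+n)
open import Data.Integer using (ℤ; +_; -_; _+_; _*_)
import Data.Integer.Properties as ℤ
open import Data.Integer.Tactic.RingSolver using (solve-∀)
open import Data.Bool using (Bool; true; false; not; if_then_else_; T; _∧_)
open import Data.Bool.Properties using (not-involutive; ∧-assoc; ∧-identityʳ)
open import Data.Empty using (⊥; ⊥-elim)
open import Data.Unit using (⊤; tt)
open import Data.Product using (Σ; _×_; _,_; proj₁; proj₂)
open import Data.Product.Algebra using (×-comm)
open import Data.Product.Function.NonDependent.Propositional using (_×-↔_)
open import Data.Product.Function.Dependent.Propositional using (Σ-↔)
open import Data.Sum using (_⊎_; inj₁; inj₂; [_,_])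
open import Data.Sum.Function.Propositional using (_⊎-↔_)
open import Data.Fin using (Fin)
open import Data.Fin.Properties using (+↔⊎; *↔×)
open import Data.Vec using (Vec; []; _∷_)
open import Function using (_∘_)
open import Function.Bundles using (_↔_; mk↔ₛ′; Inverse)
open import Function.Properties.Inverse using (↔-sym; ↔-trans)
open import Level using (0ℓ)
open import Algebra.Bundles using (CommutativeMonoid)
import Algebra.Solver.CommutativeMonoid as CommutativeMonoidSolver
open import Relation.Nullary using (Dec; yes; no)
open import Relation.Nullary.Decidable using (⌊_⌋)
open import Relation.Binary.Bundles using (Setoid)
import Relation.Binary.Reasoning.Setoid as SetoidReasoning
open import Relation.Binary.PropositionalEquality using (_≡_; refl; sym; trans; cong; cong₂; subst; module ≡-Reasoning)

-- Finite sums

sumBelow-cong< : ∀ N {f g : ℕ → ℤ} → (∀ i → i < N → f i ≡ g i) → sumBelow N f ≡ sumBelow N g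
sumBelow-cong< zero f≡g = refl
sumBelow-cong< (suc N) f≡g =
  cong₂ _+_ (sumBelow-cong< N (λ i i<N → f≡g i (ℕ.m≤n⇒m≤1+n i<N))) (f≡g N ℕ.≤-refl)

sumBelow-cong : ∀ N {f g : ℕ → ℤ} → (∀ i → f i ≡ g i) → sumBelow N f ≡ sumBelow N g
sumBelow-cong N f≡g = sumBelow-cong< N (λ i _ → f≡g i)

sumBelow-suc : ∀ N (f : ℕ → ℤ) → sumBelow (suc N) f ≡ f 0 + sumBelow N (f ∘ suc)
sumBelow-suc zero f = trans (ℤ.+-identityˡ (f 0)) (sym (ℤ.+-identityʳ (f 0)))
sumBelow-suc (suc N) f = begin
  sumBelow (suc N) f + f (suc N)            ≡⟨ cong (_+ f (suc N)) (sumBelow-suc N f) ⟩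
  (f 0 + sumBelow N (f ∘ suc)) + f (suc N)  ≡⟨ ℤ.+-assoc (f 0) _ _ ⟩
  f 0 + sumBelow (suc N) (f ∘ suc)          ∎
  where open ≡-Reasoning

sumBelow-+ : ∀ N (f g : ℕ → ℤ) → sumBelow N (λ i → f i + g i) ≡ sumBelow N f + sumBelow N g
sumBelow-+ zero f g = refl
sumBelow-+ (suc N) f g =
  trans (cong (_+ (f N + g N)) (sumBelow-+ N f g)) (medial (sumBelow N f) (sumBelow N g) (f N) (g N))
  where
  medial : ∀ a b c d → (a + b) + (c + d) ≡ (a + c) + (b + d)
  medial = solve-∀

sumBelow-*ˡ : ∀ N c (f : ℕ → ℤ) → sumBelow N (λ i → c * f i) ≡ c * sumBelow N f
sumBelow-*ˡ zero c f = sym (ℤ.*-zeroʳ c)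
sumBelow-*ˡ (suc N) c f =
  trans (cong (_+ c * f N) (sumBelow-*ˡ N c f)) (sym (ℤ.*-distribˡ-+ c (sumBelow N f) (f N)))

sumBelow-zero : ∀ N (f : ℕ → ℤ) → (∀ i → f i ≡ + 0) → sumBelow N f ≡ + 0
sumBelow-zero zero f f≡0 = refl
sumBelow-zero (suc N) f f≡0 = cong₂ _+_ (sumBelow-zero N f f≡0) (f≡0 N)

sumBelow-reverse : ∀ n (f : ℕ → ℤ) → sumBelow (suc n) f ≡ sumBelow (suc n) (λ i → f (n ∸ i))
sumBelow-reverse zero f = refl
sumBelow-reverse (suc n) f = begin
  sumBelow (suc n) f + f (suc n)                     ≡⟨ cong (_+ f (suc n)) (sumBelow-reverse n f) ⟩
  sumBelow (suc n) (λ i → f (n ∸ i)) + f (suc n)     ≡⟨ ℤ.+-comm _ (f (suc n)) ⟩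
  f (suc n) + sumBelow (suc n) (λ i → f (n ∸ i))     ≡⟨ sumBelow-suc (suc n) (λ i → f (suc n ∸ i)) ⟨
  sumBelow (suc (suc n)) (λ i → f (suc n ∸ i))       ∎
  where open ≡-Reasoning

sumBelow-vanishing : ∀ a b (f : ℕ → ℤ) → (∀ k → a ≤ k → f k ≡ + 0) → sumBelow (a +ℕ b) f ≡ sumBelow a f
sumBelow-vanishing a zero f f≡0 = cong (λ x → sumBelow x f) (ℕ.+-identityʳ a)
sumBelow-vanishing a (suc b) f f≡0 = begin
  sumBelow (a +ℕ suc b) f             ≡⟨ cong (λ x → sumBelow x f) (ℕ.+-suc a b) ⟩
  sumBelow (a +ℕ b) f + f (a +ℕ b)    ≡⟨ cong₂ _+_ (sumBelow-vanishing a b f f≡0) (f≡0 (a +ℕ b) (ℕ.m≤m+n a b)) ⟩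
  sumBelow a f + + 0                  ≡⟨ ℤ.+-identityʳ _ ⟩
  sumBelow a f                        ∎
  where open ≡-Reasoning

-- Formal power series: coefficientwise equality and the Cauchy product

infix 4 _≈_ _≈[_]_

_≈_ : Series → Series → Set
f ≈ g = ∀ n → f n ≡ g n

_≈[_]_ : Series → ℕ → Series → Set
f ≈[ N ] g = ∀ i → i ≤ N → f i ≡ g i

≈-setoid : Setoid 0ℓ 0ℓ
≈-setoid = record
  { Carrier = Series
  ; _≈_ = _≈_
  ; isEquivalence = record
    { refl = λ _ → refl ; sym = λ f≈g n → sym (f≈g n) ; trans = λ f≈g g≈h n → trans (f≈g n) (g≈h n) } }

open Setoid ≈-setoid using () renaming (refl to ≈-refl; sym to ≈-sym; trans to ≈-trans)
module ≈-Reasoning = SetoidReasoning ≈-setoid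

≈⇒≈[] : ∀ {f g N} → f ≈ g → f ≈[ N ] g
≈⇒≈[] f≈g i _ = f≈g i

≈[]-trans : ∀ {f g h N} → f ≈[ N ] g → g ≈[ N ] h → f ≈[ N ] h
≈[]-trans f≈g g≈h i i≤N = trans (f≈g i i≤N) (g≈h i i≤N)

zeroS : Series
zeroS _ = + 0

_·_ : ℤ → Series → Series
(c · f) n = c * f n

⊕-cong : ∀ {f f' g g'} → f ≈ f' → g ≈ g' → f ⊕ g ≈ f' ⊕ g'
⊕-cong f≈f' g≈g' n = cong₂ _+_ (f≈f' n) (g≈g' n)

⊗-cong : ∀ {f f' g g'} → f ≈ f' → g ≈ g' → f ⊗ g ≈ f' ⊗ g'
⊗-cong f≈f' g≈g' n = sumBelow-cong (suc n) (λ i → cong₂ _*_ (f≈f' i) (g≈g' (n ∸ i)))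

⊗-congˡ : ∀ {f f'} g → f ≈ f' → f ⊗ g ≈ f' ⊗ g
⊗-congˡ g f≈f' = ⊗-cong {g = g} {g} f≈f' (λ _ → refl)

⊗-congʳ : ∀ f {g g'} → g ≈ g' → f ⊗ g ≈ f ⊗ g'
⊗-congʳ f = ⊗-cong {f} {f} (λ _ → refl)

⊗-cong[] : ∀ {f f' g g' N} → f ≈[ N ] f' → g ≈[ N ] g' → f ⊗ g ≈[ N ] f' ⊗ g'
⊗-cong[] f≈f' g≈g' n n≤N = sumBelow-cong< (suc n) λ i i≤n →
  cong₂ _*_ (f≈f' i (ℕ.≤-trans (ℕ.≤-pred i≤n) n≤N)) (g≈g' (n ∸ i) (ℕ.≤-trans (ℕ.m∸n≤m n i) n≤N))

⊗-zero : ∀ f g → (f ⊗ g) 0 ≡ f 0 * g 0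
⊗-zero f g = ℤ.+-identityˡ _

⊗-suc : ∀ f g n → (f ⊗ g) (suc n) ≡ f 0 * g (suc n) + ((f ∘ suc) ⊗ g) n
⊗-suc f g n = sumBelow-suc (suc n) (λ i → f i * g (suc n ∸ i))

⊗-comm : ∀ f g → f ⊗ g ≈ g ⊗ f
⊗-comm f g n = trans (sumBelow-reverse n (λ i → f i * g (n ∸ i))) (sumBelow-cong< (suc n) λ i i≤n →
  trans (ℤ.*-comm (f (n ∸ i)) _) (cong (λ j → g j * f (n ∸ i)) (ℕ.m∸[m∸n]≡n (ℕ.≤-pred i≤n))))

⊗-distribʳ-⊕ : ∀ f g h → (f ⊕ g) ⊗ h ≈ (f ⊗ h) ⊕ (g ⊗ h)
⊗-distribʳ-⊕ f g h n = trans (sumBelow-cong (suc n) (λ i → ℤ.*-distribʳ-+ (h (n ∸ i)) (f i) (g i)))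
  (sumBelow-+ (suc n) _ _)

⊗-distribˡ-⊕ : ∀ h f g → h ⊗ (f ⊕ g) ≈ (h ⊗ f) ⊕ (h ⊗ g)
⊗-distribˡ-⊕ h f g = begin
  h ⊗ (f ⊕ g)          ≈⟨ ⊗-comm h (f ⊕ g) ⟩
  (f ⊕ g) ⊗ h          ≈⟨ ⊗-distribʳ-⊕ f g h ⟩
  (f ⊗ h) ⊕ (g ⊗ h)    ≈⟨ ⊕-cong (⊗-comm f h) (⊗-comm g h) ⟩
  (h ⊗ f) ⊕ (h ⊗ g)    ∎
  where open ≈-Reasoning

·-⊗ : ∀ c f h → (c · f) ⊗ h ≈ c · (f ⊗ h)
·-⊗ c f h n = trans (sumBelow-cong (suc n) (λ i → ℤ.*-assoc c (f i) (h (n ∸ i)))) (sumBelow-*ˡ (suc n) c _)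

⊗-zeroˡ : ∀ h → zeroS ⊗ h ≈ zeroS
⊗-zeroˡ h n = sumBelow-zero (suc n) _ (λ _ → refl)

⊗-identityˡ : ∀ f → oneS ⊗ f ≈ f
⊗-identityˡ f zero = trans (⊗-zero oneS f) (ℤ.*-identityˡ (f 0))
⊗-identityˡ f (suc n) = trans (⊗-suc oneS f n)
  (trans (cong₂ _+_ (ℤ.*-identityˡ (f (suc n))) (⊗-zeroˡ f n)) (ℤ.+-identityʳ _))

⊗-identityʳ : ∀ f → f ⊗ oneS ≈ f
⊗-identityʳ f = ≈-trans (⊗-comm f oneS) (⊗-identityˡ f)

⊗-assoc : ∀ f g h → (f ⊗ g) ⊗ h ≈ f ⊗ (g ⊗ h)
⊗-assoc f g h zero = begin
  ((f ⊗ g) ⊗ h) 0      ≡⟨ ⊗-zero (f ⊗ g) h ⟩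
  (f ⊗ g) 0 * h 0      ≡⟨ cong (_* h 0) (⊗-zero f g) ⟩
  f 0 * g 0 * h 0      ≡⟨ ℤ.*-assoc (f 0) (g 0) (h 0) ⟩
  f 0 * (g 0 * h 0)    ≡⟨ cong (f 0 *_) (⊗-zero g h) ⟨
  f 0 * (g ⊗ h) 0      ≡⟨ ⊗-zero f (g ⊗ h) ⟨
  (f ⊗ (g ⊗ h)) 0      ∎
  where open ≡-Reasoning
⊗-assoc f g h (suc n) = begin
  ((f ⊗ g) ⊗ h) (suc n)
    ≡⟨ ⊗-suc (f ⊗ g) h n ⟩
  (f ⊗ g) 0 * h (suc n) + (((f ⊗ g) ∘ suc) ⊗ h) n
    ≡⟨ cong₂ _+_ (cong (_* h (suc n)) (⊗-zero f g)) (⊗-congˡ h (⊗-suc f g) n) ⟩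
  f 0 * g 0 * h (suc n) + (((f 0 · (g ∘ suc)) ⊕ ((f ∘ suc) ⊗ g)) ⊗ h) n
    ≡⟨ cong (λ x → f 0 * g 0 * h (suc n) + x) (⊗-distribʳ-⊕ (f 0 · (g ∘ suc)) ((f ∘ suc) ⊗ g) h n) ⟩
  f 0 * g 0 * h (suc n) + (((f 0 · (g ∘ suc)) ⊗ h) n + (((f ∘ suc) ⊗ g) ⊗ h) n)
    ≡⟨ cong₂ (λ a b → f 0 * g 0 * h (suc n) + (a + b)) (·-⊗ (f 0) (g ∘ suc) h n) (⊗-assoc (f ∘ suc) g h n) ⟩
  f 0 * g 0 * h (suc n) + (f 0 * ((g ∘ suc) ⊗ h) n + ((f ∘ suc) ⊗ (g ⊗ h)) n)
    ≡⟨ regroup (f 0) (g 0) (h (suc n)) _ _ ⟩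
  f 0 * (g 0 * h (suc n) + ((g ∘ suc) ⊗ h) n) + ((f ∘ suc) ⊗ (g ⊗ h)) n
    ≡⟨ cong (λ x → f 0 * x + ((f ∘ suc) ⊗ (g ⊗ h)) n) (⊗-suc g h n) ⟨
  f 0 * (g ⊗ h) (suc n) + ((f ∘ suc) ⊗ (g ⊗ h)) n
    ≡⟨ ⊗-suc f (g ⊗ h) n ⟨
  (f ⊗ (g ⊗ h)) (suc n) ∎
  where
  open ≡-Reasoning
  regroup : ∀ a b c d e → a * b * c + (a * d + e) ≡ a * (b * c + d) + e
  regroup = solve-∀

sumSeries : ℕ → (ℕ → Series) → Series
sumSeries N Y i = sumBelow N (λ k → Y k i)

sumSeries-cong : ∀ N {Y Y'} → (∀ k → Y k ≈ Y' k) → sumSeries N Y ≈ sumSeries N Y'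
sumSeries-cong N Y≈Y' i = sumBelow-cong N (λ k → Y≈Y' k i)

⊗-sumSeries : ∀ Z N Y → Z ⊗ sumSeries N Y ≈ sumSeries N (λ k → Z ⊗ Y k)
⊗-sumSeries Z zero Y i = trans (⊗-comm Z (sumSeries zero Y) i) (⊗-zeroˡ Z i)
⊗-sumSeries Z (suc N) Y i =
  trans (⊗-distribˡ-⊕ Z (sumSeries N Y) (Y N) i) (cong (_+ (Z ⊗ Y N) i) (⊗-sumSeries Z N Y i))

⊗-commutativeMonoid : CommutativeMonoid 0ℓ 0ℓ
⊗-commutativeMonoid = record
  { Carrier = Series
  ; _≈_ = _≈_
  ; _∙_ = _⊗_
  ; ε = oneS
  ; isCommutativeMonoid = record
    { isMonoid = record
      { isSemigroup = record
        { isMagma = record { isEquivalence = Setoid.isEquivalence ≈-setoid ; ∙-cong = ⊗-cong }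
        ; assoc = ⊗-assoc }
      ; identity = ⊗-identityˡ , ⊗-identityʳ }
    ; comm = ⊗-comm } }

module ⊗-Solver = CommutativeMonoidSolver ⊗-commutativeMonoid

-- Monomials and finite products

shiftBy : ℕ → Series → Series
shiftBy zero h = h
shiftBy (suc k) h = shiftS (shiftBy k h)

shiftBy-+ : ∀ k h n → shiftBy k h (k +ℕ n) ≡ h n
shiftBy-+ zero h n = refl
shiftBy-+ (suc k) h n = shiftBy-+ k h n

shiftBy-< : ∀ k h {m} → m < k → shiftBy k h m ≡ + 0
shiftBy-< (suc k) h {zero} _ = refl
shiftBy-< (suc k) h {suc m} (s≤s m<k) = shiftBy-< k h m<k

shiftS-cong : ∀ {f g} → f ≈ g → shiftS f ≈ shiftS g
shiftS-cong f≈g zero = refl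
shiftS-cong f≈g (suc n) = f≈g n

shiftS-⊗ : ∀ f g → shiftS f ⊗ g ≈ shiftS (f ⊗ g)
shiftS-⊗ f g zero = ⊗-zero (shiftS f) g
shiftS-⊗ f g (suc n) = trans (⊗-suc (shiftS f) g n) (ℤ.+-identityˡ _)

mono-suc : ∀ k → mono (suc k) ≈ shiftS (mono k)
mono-suc k zero = refl
mono-suc k (suc n) = refl

mono-< : ∀ k {j} → j < k → mono k j ≡ + 0
mono-< (suc k) {zero} _ = refl
mono-< (suc k) {suc j} (s≤s j<k) = mono-< k j<k

mono-⊗ : ∀ k h → mono k ⊗ h ≈ shiftBy k h
mono-⊗ zero h = ⊗-identityˡ h
mono-⊗ (suc k) h zero = ⊗-zero (mono (suc k)) h
mono-⊗ (suc k) h (suc n) = trans (⊗-suc (mono (suc k)) h n) (trans (ℤ.+-identityˡ _) (mono-⊗ k h n))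

mono-⊗-< : ∀ k h {m} → m < k → (mono k ⊗ h) m ≡ + 0
mono-⊗-< k h {m} m<k = trans (mono-⊗ k h m) (shiftBy-< k h m<k)

mono-+ : ∀ x y → mono (x +ℕ y) ≈ mono x ⊗ mono y
mono-+ x y = ≈-trans (shifted x) (≈-sym (mono-⊗ x (mono y)))
  where
  shifted : ∀ x → mono (x +ℕ y) ≈ shiftBy x (mono y)
  shifted zero = ≈-refl
  shifted (suc x) = ≈-trans (mono-suc (x +ℕ y)) (shiftS-cong (shifted x))

prodFrom : (ℕ → Series) → ℕ → ℕ → Series
prodFrom F s zero = oneS
prodFrom F s (suc N) = F s ⊗ prodFrom F (suc s) N

prodFrom-suc : ∀ F s N → prodFrom F s (suc N) ≈ prodFrom F s N ⊗ F (s +ℕ N)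
prodFrom-suc F s zero = begin
  F s ⊗ oneS           ≈⟨ ⊗-identityʳ (F s) ⟩
  F s                  ≡⟨ cong F (ℕ.+-identityʳ s) ⟨
  F (s +ℕ 0)           ≈⟨ ⊗-identityˡ (F (s +ℕ 0)) ⟨
  oneS ⊗ F (s +ℕ 0)    ∎
  where open ≈-Reasoning
prodFrom-suc F s (suc N) = begin
  F s ⊗ prodFrom F (suc s) (suc N)                 ≈⟨ ⊗-congʳ (F s) (prodFrom-suc F (suc s) N) ⟩
  F s ⊗ (prodFrom F (suc s) N ⊗ F (suc s +ℕ N))    ≈⟨ ⊗-assoc (F s) (prodFrom F (suc s) N) (F (suc s +ℕ N)) ⟨
  prodFrom F s (suc N) ⊗ F (suc s +ℕ N)            ≡⟨ cong (λ j → prodFrom F s (suc N) ⊗ F j) (ℕ.+-suc s N) ⟨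
  prodFrom F s (suc N) ⊗ F (s +ℕ suc N)            ∎
  where open ≈-Reasoning

prodBelow≈prodFrom : ∀ F N → prodBelow N F ≈ prodFrom F 0 N
prodBelow≈prodFrom F zero = ≈-refl
prodBelow≈prodFrom F (suc N) = ≈-trans (⊗-congˡ (F N) (prodBelow≈prodFrom F N)) (≈-sym (prodFrom-suc F 0 N))

prodFrom-+ : ∀ F s K M → prodFrom F s (K +ℕ M) ≈ prodFrom F s K ⊗ prodFrom F (K +ℕ s) M
prodFrom-+ F s zero M = ≈-sym (⊗-identityˡ _)
prodFrom-+ F s (suc K) M = begin
  F s ⊗ prodFrom F (suc s) (K +ℕ M)                         ≈⟨ ⊗-congʳ (F s) (prodFrom-+ F (suc s) K M) ⟩
  F s ⊗ (prodFrom F (suc s) K ⊗ prodFrom F (K +ℕ suc s) M)  ≈⟨ ⊗-assoc (F s) (prodFrom F (suc s) K) (prodFrom F (K +ℕ suc s) M) ⟨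
  prodFrom F s (suc K) ⊗ prodFrom F (K +ℕ suc s) M          ≡⟨ cong (λ j → prodFrom F s (suc K) ⊗ prodFrom F j M) (ℕ.+-suc K s) ⟩
  prodFrom F s (suc K) ⊗ prodFrom F (suc K +ℕ s) M          ∎
  where open ≈-Reasoning

prodFrom-≈[]-oneS : ∀ F N s → (∀ j → s ≤ j → F j ≈[ N ] oneS) → ∀ M → prodFrom F s M ≈[ N ] oneS
prodFrom-≈[]-oneS F N s F≈1 zero = λ _ _ → refl
prodFrom-≈[]-oneS F N s F≈1 (suc M) = ≈[]-trans
  (⊗-cong[] (F≈1 s ℕ.≤-refl) (prodFrom-≈[]-oneS F N (suc s) (λ j s<j → F≈1 j (ℕ.<⇒≤ s<j)) M))
  (≈⇒≈[] (⊗-identityˡ oneS))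

-- The substitution q ↦ -q

∣?-+-cancelˡ : ∀ d m → ⌊ d ∣? (d +ℕ m) ⌋ ≡ ⌊ d ∣? m ⌋
∣?-+-cancelˡ d m with d ∣? (d +ℕ m) | d ∣? m
... | yes _      | yes _     = refl
... | yes d∣d+m  | no d∤m    = ⊥-elim (d∤m (∣m+n∣m⇒∣n d∣d+m ∣-refl))
... | no d∤d+m   | yes d∣m   = ⊥-elim (d∤d+m (∣m∣n⇒∣m+n ∣-refl d∣m))
... | no _       | no _      = refl

isEven : ℕ → Bool
isEven zero = true
isEven (suc n) = not (isEven n)

isEven-∣? : ∀ n → ⌊ 2 ∣? n ⌋ ≡ isEven n
isEven-∣? zero = refl
isEven-∣? (suc zero) = refl
isEven-∣? (suc (suc n)) =
  trans (∣?-+-cancelˡ 2 n) (trans (isEven-∣? n) (sym (not-involutive (isEven n))))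

signed : ℕ → ℤ → ℤ
signed n x = if isEven n then x else - x

negArg-signed : ∀ f n → negArg f n ≡ signed n (f n)
negArg-signed f n = cong (λ b → if b then f n else - f n) (isEven-∣? n)

signed-suc : ∀ n x → signed (suc n) x ≡ - signed n x
signed-suc n x with isEven n
... | true = refl
... | false = sym (ℤ.neg-involutive x)

signed-zero : ∀ n → signed n (+ 0) ≡ + 0
signed-zero n with isEven n
... | true = refl
... | false = refl

signed-+ : ∀ n x y → signed n (x + y) ≡ signed n x + signed n y
signed-+ n x y with isEven n
... | true = refl
... | false = ℤ.neg-distrib-+ x y

signed-involutive : ∀ n x → signed n (signed n x) ≡ x
signed-involutive n x with isEven n
... | true = refl
... | false = ℤ.neg-involutive x

signed-*ʳ : ∀ n x y → signed n (x * y) ≡ x * signed n y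
signed-*ʳ n x y with isEven n
... | true = refl
... | false = ℤ.neg-distribʳ-* x y

signed-+ℕ : ∀ i j x → signed (i +ℕ j) x ≡ signed i (signed j x)
signed-+ℕ zero j x = refl
signed-+ℕ (suc i) j x = begin
  signed (suc i +ℕ j) x        ≡⟨ signed-suc (i +ℕ j) x ⟩
  - signed (i +ℕ j) x          ≡⟨ cong -_ (signed-+ℕ i j x) ⟩
  - signed i (signed j x)      ≡⟨ signed-suc i (signed j x) ⟨
  signed (suc i) (signed j x)  ∎
  where open ≡-Reasoning

signed-* : ∀ i j x y → signed (i +ℕ j) (x * y) ≡ signed i x * signed j y
signed-* zero j x y = signed-*ʳ j x y
signed-* (suc i) j x y = begin
  signed (suc i +ℕ j) (x * y)       ≡⟨ signed-suc (i +ℕ j) (x * y) ⟩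
  - signed (i +ℕ j) (x * y)         ≡⟨ cong -_ (signed-* i j x y) ⟩
  - (signed i x * signed j y)       ≡⟨ ℤ.neg-distribˡ-* (signed i x) (signed j y) ⟩
  - signed i x * signed j y         ≡⟨ cong (_* signed j y) (signed-suc i x) ⟨
  signed (suc i) x * signed j y     ∎
  where open ≡-Reasoning

signed-sumBelow : ∀ n N h → signed n (sumBelow N h) ≡ sumBelow N (signed n ∘ h)
signed-sumBelow n zero h = signed-zero n
signed-sumBelow n (suc N) h =
  trans (signed-+ n (sumBelow N h) (h N)) (cong (_+ signed n (h N)) (signed-sumBelow n N h))

signed-double : ∀ k x → signed (k +ℕ k) x ≡ x
signed-double k x = trans (signed-+ℕ k k x) (signed-involutive k x)

negArg-cong : ∀ {f g} → f ≈ g → negArg f ≈ negArg g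
negArg-cong {f} {g} f≈g n = trans (negArg-signed f n) (trans (cong (signed n) (f≈g n)) (sym (negArg-signed g n)))

negArg-⊗ : ∀ f g → negArg (f ⊗ g) ≈ negArg f ⊗ negArg g
negArg-⊗ f g n = begin
  negArg (f ⊗ g) n                                   ≡⟨ negArg-signed (f ⊗ g) n ⟩
  signed n ((f ⊗ g) n)                               ≡⟨ signed-sumBelow n (suc n) _ ⟩
  sumBelow (suc n) (λ i → signed n (f i * g (n ∸ i))) ≡⟨ sumBelow-cong< (suc n) signed-term ⟩
  (negArg f ⊗ negArg g) n                            ∎
  where
  open ≡-Reasoning
  signed-term : ∀ i → i < suc n → signed n (f i * g (n ∸ i)) ≡ negArg f i * negArg g (n ∸ i)
  signed-term i i≤n = begin
    signed n (f i * g (n ∸ i))                 ≡⟨ cong (λ m → signed m (f i * g (n ∸ i))) (ℕ.m+[n∸m]≡n (ℕ.≤-pred i≤n)) ⟨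
    signed (i +ℕ (n ∸ i)) (f i * g (n ∸ i))    ≡⟨ signed-* i (n ∸ i) (f i) (g (n ∸ i)) ⟩
    signed i (f i) * signed (n ∸ i) (g (n ∸ i)) ≡⟨ cong₂ _*_ (negArg-signed f i) (negArg-signed g (n ∸ i)) ⟨
    negArg f i * negArg g (n ∸ i)              ∎

negArg-oneS : negArg oneS ≈ oneS
negArg-oneS zero = refl
negArg-oneS (suc n) = trans (negArg-signed oneS (suc n)) (signed-zero (suc n))

negArg-prodBelow : ∀ N F → negArg (prodBelow N F) ≈ prodBelow N (negArg ∘ F)
negArg-prodBelow zero F = negArg-oneS
negArg-prodBelow (suc N) F =
  ≈-trans (negArg-⊗ (prodBelow N F) (F N)) (⊗-congˡ (negArg (F N)) (negArg-prodBelow N F))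

negArg-sumSeries : ∀ N F → negArg (sumSeries N F) ≈ sumSeries N (negArg ∘ F)
negArg-sumSeries N F i = begin
  negArg (sumSeries N F) i               ≡⟨ negArg-signed (sumSeries N F) i ⟩
  signed i (sumBelow N (λ m → F m i))    ≡⟨ signed-sumBelow i N (λ m → F m i) ⟩
  sumBelow N (λ m → signed i (F m i))    ≡⟨ sumBelow-cong N (λ m → negArg-signed (F m) i) ⟨
  sumSeries N (negArg ∘ F) i             ∎
  where open ≡-Reasoning

signed-mono : ∀ e i → signed i (mono e i) ≡ signed e (mono e i)
signed-mono zero zero = refl
signed-mono zero (suc i) = signed-zero (suc i)
signed-mono (suc e) zero = sym (signed-zero (suc e))
signed-mono (suc e) (suc i) =
  trans (signed-suc i (mono e i)) (trans (cong -_ (signed-mono e i)) (sym (signed-suc e (mono e i))))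

negArg-mono-double : ∀ k → negArg (mono (k +ℕ k)) ≈ mono (k +ℕ k)
negArg-mono-double k i =
  trans (negArg-signed (mono (k +ℕ k)) i) (trans (signed-mono (k +ℕ k) i) (signed-double k _))

-- Geometric series in odd powers of q

odd : ℕ → ℕ
odd s = 2 *ℕ s +ℕ 1

0<odd : ∀ s → 0 < odd s
0<odd s = ℕ.m≤n+m 1 (2 *ℕ s)

geomOdd-zero : ∀ s → geomOdd s 0 ≡ + 1
geomOdd-zero s with odd s ∣? 0
... | yes _ = refl
... | no ∤0 = ⊥-elim (∤0 (divides 0 refl))

geomOdd-< : ∀ s {n} → 0 < n → n < odd s → geomOdd s n ≡ + 0
geomOdd-< s {suc n} _ n<odd with odd s ∣? suc n
... | yes ∣n = ⊥-elim (ℕ.<⇒≱ n<odd (∣⇒≤ ∣n))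
... | no _ = refl

geomOdd-periodic : ∀ s m → geomOdd s (odd s +ℕ m) ≡ geomOdd s m
geomOdd-periodic s m = cong (λ b → if b then + 1 else + 0) (∣?-+-cancelˡ (odd s) m)

-- 1 / (1 + q^(2s+1))
altGeomOdd : ℕ → Series
altGeomOdd s = negArg (geomOdd s)

altGeomOdd-antiperiodic : ∀ s m → altGeomOdd s (odd s +ℕ m) ≡ - altGeomOdd s m
altGeomOdd-antiperiodic s m = begin
  altGeomOdd s (odd s +ℕ m)                         ≡⟨ negArg-signed (geomOdd s) (odd s +ℕ m) ⟩
  signed (odd s +ℕ m) (geomOdd s (odd s +ℕ m))      ≡⟨ cong (signed (odd s +ℕ m)) (geomOdd-periodic s m) ⟩
  signed (odd s +ℕ m) (geomOdd s m)                 ≡⟨ signed-+ℕ (odd s) m _ ⟩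
  signed (odd s) (signed m (geomOdd s m))           ≡⟨ signed-odd (signed m (geomOdd s m)) ⟩
  - signed m (geomOdd s m)                          ≡⟨ cong -_ (negArg-signed (geomOdd s) m) ⟨
  - altGeomOdd s m                                  ∎
  where
  open ≡-Reasoning
  signed-odd : ∀ y → signed (odd s) y ≡ - y
  signed-odd y = trans (signed-+ℕ (2 *ℕ s) 1 y)
    (trans (cong (λ k → signed k (- y)) (cong (s +ℕ_) (ℕ.+-identityʳ s))) (signed-double s (- y)))

altGeomOdd-< : ∀ s {n} → n < odd s → altGeomOdd s n ≡ oneS n
altGeomOdd-< s {zero} _ = trans (negArg-signed (geomOdd s) 0) (geomOdd-zero s)
altGeomOdd-< s {suc n} n<odd = trans (negArg-signed (geomOdd s) (suc n))
  (trans (cong (signed (suc n)) (geomOdd-< s (s≤s z≤n) n<odd)) (signed-zero (suc n)))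

-- Away from the first 2s+1 coefficients, the antiperiodicity makes the two summands cancel.
altGeomOdd-inverse : ∀ s → (oneS ⊕ mono (odd s)) ⊗ altGeomOdd s ≈ oneS
altGeomOdd-inverse s n = begin
  ((oneS ⊕ mono (odd s)) ⊗ altGeomOdd s) n                ≡⟨ ⊗-distribʳ-⊕ oneS (mono (odd s)) (altGeomOdd s) n ⟩
  (oneS ⊗ altGeomOdd s) n + (mono (odd s) ⊗ altGeomOdd s) n ≡⟨ cong₂ _+_ (⊗-identityˡ (altGeomOdd s) n) (mono-⊗ (odd s) (altGeomOdd s) n) ⟩
  altGeomOdd s n + shiftBy (odd s) (altGeomOdd s) n       ≡⟨ cancel n ⟩
  oneS n                                                  ∎
  where
  open ≡-Reasoning
  cancel : ∀ n → altGeomOdd s n + shiftBy (odd s) (altGeomOdd s) n ≡ oneS n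
  cancel n with n ℕ.<? odd s
  ... | yes n<odd = trans (cong₂ _+_ (altGeomOdd-< s n<odd) (shiftBy-< (odd s) (altGeomOdd s) n<odd)) (ℤ.+-identityʳ _)
  ... | no n≮odd rewrite sym (ℕ.m+[n∸m]≡n (ℕ.≮⇒≥ n≮odd)) = begin
    altGeomOdd s (odd s +ℕ m) + shiftBy (odd s) (altGeomOdd s) (odd s +ℕ m)
      ≡⟨ cong₂ _+_ (altGeomOdd-antiperiodic s m) (shiftBy-+ (odd s) (altGeomOdd s) m) ⟩
    - altGeomOdd s m + altGeomOdd s m   ≡⟨ ℤ.+-inverseˡ (altGeomOdd s m) ⟩
    + 0                                ≡⟨ oneS-positive (ℕ.≤-trans (0<odd s) (ℕ.m≤m+n (odd s) m)) ⟨
    oneS (odd s +ℕ m)                  ∎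
    where
    m = n ∸ odd s
    oneS-positive : ∀ {x} → 0 < x → oneS x ≡ + 0
    oneS-positive {suc x} _ = refl

PoBarFactor : ℕ → Series
PoBarFactor s = (oneS ⊕ mono (odd s)) ⊗ geomOdd s

PoBarFactor-⊗-altGeomOdd : ∀ s → PoBarFactor s ⊗ altGeomOdd s ≈ geomOdd s
PoBarFactor-⊗-altGeomOdd s = begin
  ((oneS ⊕ mono (odd s)) ⊗ geomOdd s) ⊗ altGeomOdd s   ≈⟨ ⊗-assoc (oneS ⊕ mono (odd s)) (geomOdd s) (altGeomOdd s) ⟩
  (oneS ⊕ mono (odd s)) ⊗ (geomOdd s ⊗ altGeomOdd s)   ≈⟨ ⊗-congʳ (oneS ⊕ mono (odd s)) (⊗-comm (geomOdd s) (altGeomOdd s)) ⟩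
  (oneS ⊕ mono (odd s)) ⊗ (altGeomOdd s ⊗ geomOdd s)   ≈⟨ ⊗-assoc (oneS ⊕ mono (odd s)) (altGeomOdd s) (geomOdd s) ⟨
  ((oneS ⊕ mono (odd s)) ⊗ altGeomOdd s) ⊗ geomOdd s   ≈⟨ ⊗-congˡ (geomOdd s) (altGeomOdd-inverse s) ⟩
  oneS ⊗ geomOdd s                                     ≈⟨ ⊗-identityˡ (geomOdd s) ⟩
  geomOdd s                                            ∎
  where open ≈-Reasoning

PoBarFactor-≈[]-oneS : ∀ N s → N < s → PoBarFactor s ≈[ N ] oneS
PoBarFactor-≈[]-oneS N s N<s =
  ≈[]-trans (⊗-cong[] {N = N} no-mono no-geom) (≈⇒≈[] (≈-trans (⊗-identityʳ _) (λ n → ℤ.+-identityʳ (oneS n))))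
  where
  <odd : ∀ {j} → j ≤ N → j < odd s
  <odd j≤N = ℕ.≤-trans (s≤s j≤N) (ℕ.≤-trans N<s (ℕ.≤-trans (ℕ.m≤m+n s (s +ℕ 0)) (ℕ.m≤m+n (2 *ℕ s) 1)))
  no-mono : (oneS ⊕ mono (odd s)) ≈[ N ] (oneS ⊕ zeroS)
  no-mono j j≤N = cong (λ x → oneS j + x) (mono-< (odd s) (<odd j≤N))
  no-geom : geomOdd s ≈[ N ] oneS
  no-geom zero _ = geomOdd-zero s
  no-geom (suc j) j≤N = geomOdd-< s (s≤s z≤n) (<odd j≤N)

-- The generating function of valid vectors and the right-hand side

-- q^(omoExponent s k) is the least weight of a valid vector starting at the part 2s+1 whose
-- run of overlined parts has length k: the parts 2j+1 and overlined 2j+1 for s ≤ j < s+k, then 2(s+k)+1.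
omoExponent : ℕ → ℕ → ℕ
omoExponent s zero = odd s
omoExponent s (suc k) = (odd s +ℕ odd s) +ℕ omoExponent (suc s) k

omoSeries : ℕ → ℕ → Series
omoSeries s L = sumSeries L λ k →
  mono (omoExponent s k) ⊗ (prodFrom PoBarFactor s L ⊗ prodFrom altGeomOdd s (suc k))

-- In each summand, PoBarFactor s ⊗ altGeomOdd s collapses to geomOdd s.
omoSeries-suc : ∀ s L → omoSeries s (suc L) ≈
  ((mono (odd s) ⊗ geomOdd s) ⊗ prodFrom PoBarFactor (suc s) L) ⊕ ((mono (odd s +ℕ odd s) ⊗ geomOdd s) ⊗ omoSeries (suc s) L)
omoSeries-suc s L i = begin
  omoSeries s (suc L) i                            ≡⟨ sumBelow-suc L (λ k → X k i) ⟩
  X 0 i + sumBelow L (λ k → X (suc k) i)           ≡⟨ cong₂ _+_ (head i) (sumBelow-cong L (λ k → tail k i)) ⟩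
  ((mono (odd s) ⊗ geomOdd s) ⊗ P) i + sumSeries L (λ k → Z ⊗ Y k) i
                                                   ≡⟨ cong (λ x → ((mono (odd s) ⊗ geomOdd s) ⊗ P) i + x) (⊗-sumSeries Z L Y i) ⟨
  ((mono (odd s) ⊗ geomOdd s) ⊗ P) i + (Z ⊗ omoSeries (suc s) L) i ∎
  where
  open ≡-Reasoning
  open ⊗-Solver using (solve; _⊜_; id) renaming (_⊕_ to _⊛_)
  P = prodFrom PoBarFactor (suc s) L
  Z = mono (odd s +ℕ odd s) ⊗ geomOdd s
  X = λ k → mono (omoExponent s k) ⊗ (prodFrom PoBarFactor s (suc L) ⊗ prodFrom altGeomOdd s (suc k))
  Y = λ k → mono (omoExponent (suc s) k) ⊗ (P ⊗ prodFrom altGeomOdd (suc s) (suc k))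
  head : X 0 ≈ (mono (odd s) ⊗ geomOdd s) ⊗ P
  head = ≈-trans
    (solve 4 (λ x f p g → x ⊛ ((f ⊛ p) ⊛ (g ⊛ id)) ⊜ (x ⊛ (f ⊛ g)) ⊛ p) (λ _ → refl)
      (mono (odd s)) (PoBarFactor s) P (altGeomOdd s))
    (⊗-congˡ P (⊗-congʳ (mono (odd s)) (PoBarFactor-⊗-altGeomOdd s)))
  tail : ∀ k → X (suc k) ≈ Z ⊗ Y k
  tail k = ≈-trans (⊗-congˡ (prodFrom PoBarFactor s (suc L) ⊗ prodFrom altGeomOdd s (suc (suc k)))
                              (mono-+ (odd s +ℕ odd s) (omoExponent (suc s) k)))
    (≈-trans (solve 6 (λ m c f p g q → (m ⊛ c) ⊛ ((f ⊛ p) ⊛ (g ⊛ q)) ⊜ (m ⊛ (f ⊛ g)) ⊛ (c ⊛ (p ⊛ q))) (λ _ → refl)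
               (mono (odd s +ℕ odd s)) (mono (omoExponent (suc s) k)) (PoBarFactor s) P (altGeomOdd s)
               (prodFrom altGeomOdd (suc s) (suc k)))
      (⊗-congˡ (Y k) (⊗-congʳ (mono (odd s +ℕ odd s)) (PoBarFactor-⊗-altGeomOdd s))))

mockExponent : ℕ → ℕ
mockExponent m = 2 *ℕ m *ℕ m +ℕ 2 *ℕ m

omoExponent-closed : ∀ s k → omoExponent s k ≡ suc (mockExponent k +ℕ 2 *ℕ s *ℕ (2 *ℕ k +ℕ 1))
omoExponent-closed s zero = base s
  where
  base : ∀ s → 2 *ℕ s +ℕ 1 ≡ suc (2 *ℕ 0 *ℕ 0 +ℕ 2 *ℕ 0 +ℕ 2 *ℕ s *ℕ (2 *ℕ 0 +ℕ 1))
  base = ℕ-Solver.solve-∀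
omoExponent-closed s (suc k) = trans (cong ((odd s +ℕ odd s) +ℕ_) (omoExponent-closed (suc s) k)) (step s k)
  where
  step : ∀ s k → (2 *ℕ s +ℕ 1 +ℕ (2 *ℕ s +ℕ 1)) +ℕ suc (2 *ℕ k *ℕ k +ℕ 2 *ℕ k +ℕ 2 *ℕ suc s *ℕ (2 *ℕ k +ℕ 1))
               ≡ suc (2 *ℕ suc k *ℕ suc k +ℕ 2 *ℕ suc k +ℕ 2 *ℕ s *ℕ (2 *ℕ suc k +ℕ 1))
  step = ℕ-Solver.solve-∀

omoExponent-zero : ∀ k → omoExponent 0 k ≡ suc (mockExponent k)
omoExponent-zero k = trans (omoExponent-closed 0 k) (cong suc (ℕ.+-identityʳ (mockExponent k)))

mockExponent-double : ∀ m → mockExponent m ≡ (m *ℕ m +ℕ m) +ℕ (m *ℕ m +ℕ m)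
mockExponent-double = double
  where
  double : ∀ m → 2 *ℕ m *ℕ m +ℕ 2 *ℕ m ≡ (m *ℕ m +ℕ m) +ℕ (m *ℕ m +ℕ m)
  double = ℕ-Solver.solve-∀

-- The factors PoBarFactor s with s > n are ≡ 1 up to degree n.
PoBar-≈[] : ∀ n → PoBar ≈[ n ] prodFrom PoBarFactor 0 (suc n)
PoBar-≈[] n i i≤n = begin
  PoBar i                                                  ≡⟨ prodBelow≈prodFrom PoBarFactor (suc i) i ⟩
  prodFrom PoBarFactor 0 (suc i) i                         ≡⟨ ⊗-identityʳ (prodFrom PoBarFactor 0 (suc i)) i ⟨
  (prodFrom PoBarFactor 0 (suc i) ⊗ oneS) i                ≡⟨ ⊗-cong[] {P} {P} {N = i} (λ _ _ → refl) later-factors i ℕ.≤-refl ⟨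
  (prodFrom PoBarFactor 0 (suc i) ⊗ prodFrom PoBarFactor (suc i +ℕ 0) (n ∸ i)) i
                                                           ≡⟨ prodFrom-+ PoBarFactor 0 (suc i) (n ∸ i) i ⟨
  prodFrom PoBarFactor 0 (suc i +ℕ (n ∸ i)) i              ≡⟨ cong (λ N → prodFrom PoBarFactor 0 (suc N) i) (ℕ.m+[n∸m]≡n i≤n) ⟩
  prodFrom PoBarFactor 0 (suc n) i                         ∎
  where
  open ≡-Reasoning
  P = prodFrom PoBarFactor 0 (suc i)
  later-factors : prodFrom PoBarFactor (suc i +ℕ 0) (n ∸ i) ≈[ i ] oneS
  later-factors = prodFrom-≈[]-oneS PoBarFactor i (suc i +ℕ 0)
    (λ j i<j → PoBarFactor-≈[]-oneS i j (ℕ.≤-trans (ℕ.≤-reflexive (sym (ℕ.+-identityʳ (suc i)))) i<j)) (n ∸ i)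

F1Term : ℕ → Series
F1Term m = mono (mockExponent m) ⊗ invPochOdd m

F1-≈[] : ∀ n → F1 ≈[ n ] sumSeries (suc n) F1Term
F1-≈[] n i i≤n = begin
  F1 i                                               ≡⟨ sumBelow-vanishing (suc i) (n ∸ i) (λ m → F1Term m i) vanishing ⟨
  sumBelow (suc i +ℕ (n ∸ i)) (λ m → F1Term m i)     ≡⟨ cong (λ N → sumBelow (suc N) (λ m → F1Term m i)) (ℕ.m+[n∸m]≡n i≤n) ⟩
  sumSeries (suc n) F1Term i                         ∎
  where
  open ≡-Reasoning
  vanishing : ∀ k → suc i ≤ k → F1Term k i ≡ + 0
  vanishing k i<k = mono-⊗-< (mockExponent k) (invPochOdd k)
    (ℕ.≤-trans i<k (ℕ.≤-trans (ℕ.m≤m+n k (k +ℕ 0)) (ℕ.m≤n+m (2 *ℕ k) (2 *ℕ k *ℕ k))))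

negArg-F1Term : ∀ m → negArg (F1Term m) ≈ mono (mockExponent m) ⊗ prodFrom altGeomOdd 0 (suc m)
negArg-F1Term m = ≈-trans (negArg-⊗ (mono (mockExponent m)) (invPochOdd m))
  (⊗-cong even-exponent (≈-trans (negArg-prodBelow (suc m) geomOdd) (prodBelow≈prodFrom altGeomOdd (suc m))))
  where
  even-exponent : negArg (mono (mockExponent m)) ≈ mono (mockExponent m)
  even-exponent i = begin
    negArg (mono (mockExponent m)) i         ≡⟨ cong (λ e → negArg (mono e) i) (mockExponent-double m) ⟩
    negArg (mono (m *ℕ m +ℕ m +ℕ (m *ℕ m +ℕ m))) i ≡⟨ negArg-mono-double (m *ℕ m +ℕ m) i ⟩
    mono (m *ℕ m +ℕ m +ℕ (m *ℕ m +ℕ m)) i   ≡⟨ cong (λ e → mono e i) (mockExponent-double m) ⟨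
    mono (mockExponent m) i                  ∎
    where open ≡-Reasoning

negArg-F1-≈[] : ∀ n → negArg F1 ≈[ n ] sumSeries (suc n) (λ m → mono (mockExponent m) ⊗ prodFrom altGeomOdd 0 (suc m))
negArg-F1-≈[] n i i≤n = begin
  negArg F1 i                                      ≡⟨ negArg-signed F1 i ⟩
  signed i (F1 i)                                  ≡⟨ cong (signed i) (F1-≈[] n i i≤n) ⟩
  signed i (sumSeries (suc n) F1Term i)            ≡⟨ negArg-signed (sumSeries (suc n) F1Term) i ⟨
  negArg (sumSeries (suc n) F1Term) i              ≡⟨ negArg-sumSeries (suc n) F1Term i ⟩
  sumSeries (suc n) (negArg ∘ F1Term) i            ≡⟨ sumSeries-cong (suc n) negArg-F1Term i ⟩
  sumSeries (suc n) (λ m → mono (mockExponent m) ⊗ prodFrom altGeomOdd 0 (suc m)) i ∎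
  where open ≡-Reasoning

omoSeries≡rhsSeries : ∀ n → omoSeries 0 (suc n) (suc n) ≡ rhsSeries (suc n)
omoSeries≡rhsSeries n = begin
  omoSeries 0 (suc n) (suc n)                        ≡⟨ sumBelow-cong (suc n) unshift ⟩
  sumSeries (suc n) (λ k → mono (mockExponent k) ⊗ (P ⊗ Ψ k)) n
                                                     ≡⟨ sumSeries-cong (suc n) (λ k → swap P (mono (mockExponent k)) (Ψ k)) n ⟨
  sumSeries (suc n) (λ k → P ⊗ (mono (mockExponent k) ⊗ Ψ k)) n
                                                     ≡⟨ ⊗-sumSeries P (suc n) (λ k → mono (mockExponent k) ⊗ Ψ k) n ⟨
  (P ⊗ sumSeries (suc n) (λ k → mono (mockExponent k) ⊗ Ψ k)) n
                                                     ≡⟨ ⊗-cong[] {N = n} (PoBar-≈[] n) (negArg-F1-≈[] n) n ℕ.≤-refl ⟨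
  (PoBar ⊗ negArg F1) n                              ∎
  where
  open ≡-Reasoning
  P = prodFrom PoBarFactor 0 (suc n)
  Ψ = λ k → prodFrom altGeomOdd 0 (suc k)
  swap : ∀ p e q → p ⊗ (e ⊗ q) ≈ e ⊗ (p ⊗ q)
  swap = solve 3 (λ p e q → p ⊛ (e ⊛ q) ⊜ e ⊛ (p ⊛ q)) (λ _ → refl)
    where open ⊗-Solver using (solve; _⊜_) renaming (_⊕_ to _⊛_)
  unshift : ∀ k → (mono (omoExponent 0 k) ⊗ (P ⊗ Ψ k)) (suc n) ≡ (mono (mockExponent k) ⊗ (P ⊗ Ψ k)) n
  unshift k = begin
    (mono (omoExponent 0 k) ⊗ (P ⊗ Ψ k)) (suc n)        ≡⟨ cong (λ e → (mono e ⊗ (P ⊗ Ψ k)) (suc n)) (omoExponent-zero k) ⟩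
    (mono (suc (mockExponent k)) ⊗ (P ⊗ Ψ k)) (suc n)   ≡⟨ ⊗-congˡ (P ⊗ Ψ k) (mono-suc (mockExponent k)) (suc n) ⟩
    (shiftS (mono (mockExponent k)) ⊗ (P ⊗ Ψ k)) (suc n) ≡⟨ shiftS-⊗ (mono (mockExponent k)) (P ⊗ Ψ k) (suc n) ⟩
    (mono (mockExponent k) ⊗ (P ⊗ Ψ k)) n               ∎

-- Counting by bijections with Fin

Fiber : {X : Set} → (X → ℕ) → ℕ → Set
Fiber {X} w n = Σ X λ x → w x ≡ n

Counts : (ℕ → ℕ) → (ℕ → Set) → Set
Counts f A = ∀ n → Fin (f n) ↔ A n

convolve : (ℕ → ℕ) → (ℕ → ℕ) → ℕ → ℕ
convolve f g zero = f 0 *ℕ g 0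
convolve f g (suc n) = f 0 *ℕ g (suc n) +ℕ convolve (f ∘ suc) g n

Convolution : (ℕ → Set) → (ℕ → Set) → ℕ → Set
Convolution A B n = Σ ℕ λ i → Σ ℕ λ j → (i +ℕ j ≡ n) × (A i × B j)

module _ {A B : ℕ → Set} where

  Convolution-zero : Convolution A B 0 ↔ (A 0 × B 0)
  Convolution-zero = mk↔ₛ′ to (λ ab → 0 , 0 , refl , ab) (λ _ → refl) from∘to
    where
    to : Convolution A B 0 → A 0 × B 0
    to (zero , zero , refl , ab) = ab
    from∘to : ∀ x → (0 , 0 , refl , to x) ≡ x
    from∘to (zero , zero , refl , ab) = refl

  Convolution-suc : ∀ n → Convolution A B (suc n) ↔ ((A 0 × B (suc n)) ⊎ Convolution (A ∘ suc) B n)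
  Convolution-suc n = mk↔ₛ′ to from to∘from from∘to
    where
    to : Convolution A B (suc n) → (A 0 × B (suc n)) ⊎ Convolution (A ∘ suc) B n
    to (zero , _ , refl , ab) = inj₁ ab
    to (suc i , j , i+j≡n , ab) = inj₂ (i , j , ℕ.suc-injective i+j≡n , ab)
    from : (A 0 × B (suc n)) ⊎ Convolution (A ∘ suc) B n → Convolution A B (suc n)
    from (inj₁ ab) = 0 , suc n , refl , ab
    from (inj₂ (i , j , i+j≡n , ab)) = suc i , j , cong suc i+j≡n , ab
    to∘from : ∀ y → to (from y) ≡ y
    to∘from (inj₁ ab) = refl
    to∘from (inj₂ (i , j , i+j≡n , ab)) = cong (λ e → inj₂ (i , j , e , ab)) (ℕ.≡-irrelevant _ _)
    from∘to : ∀ x → from (to x) ≡ x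
    from∘to (zero , _ , refl , ab) = refl
    from∘to (suc i , j , i+j≡n , ab) = cong (λ e → suc i , j , e , ab) (ℕ.≡-irrelevant _ _)

Counts-convolve : ∀ {A B f g} → Counts f A → Counts g B → Counts (convolve f g) (Convolution A B)
Counts-convolve cA cB zero = ↔-trans *↔× (↔-trans (cA 0 ×-↔ cB 0) (↔-sym Convolution-zero))
Counts-convolve cA cB (suc n) = ↔-trans +↔⊎
  (↔-trans (↔-trans *↔× (cA 0 ×-↔ cB (suc n)) ⊎-↔ Counts-convolve (cA ∘ suc) cB n) (↔-sym (Convolution-suc n)))

Counts-↔ : ∀ {A B f} → Counts f A → (∀ n → A n ↔ B n) → Counts f B
Counts-↔ c A↔B n = ↔-trans (c n) (A↔B n)

≡-↔ : ∀ {a b c d : ℕ} → (a ≡ b → c ≡ d) → (c ≡ d → a ≡ b) → (a ≡ b) ↔ (c ≡ d)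
≡-↔ f g = mk↔ₛ′ f g (λ _ → ℕ.≡-irrelevant _ _) (λ _ → ℕ.≡-irrelevant _ _)

Fiber-↔ : ∀ {X Y : Set} {wX : X → ℕ} {wY : Y → ℕ} (X↔Y : X ↔ Y) → (∀ x → wY (Inverse.to X↔Y x) ≡ wX x) →
          ∀ n → Fiber wX n ↔ Fiber wY n
Fiber-↔ X↔Y w≡w n = Σ-↔ X↔Y λ {x} → ≡-↔ (trans (w≡w x)) (trans (sym (w≡w x)))

module _ {X Y : Set} (wX : X → ℕ) (wY : Y → ℕ) where

  Fiber-× : ∀ n → Fiber (λ (p : X × Y) → wX (proj₁ p) +ℕ wY (proj₂ p)) n ↔ Convolution (Fiber wX) (Fiber wY) n
  Fiber-× n = mk↔ₛ′ to from to∘from (λ _ → refl)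
    where
    to : Fiber (λ (p : X × Y) → wX (proj₁ p) +ℕ wY (proj₂ p)) n → Convolution (Fiber wX) (Fiber wY) n
    to ((x , y) , e) = wX x , wY y , e , (x , refl) , (y , refl)
    from : Convolution (Fiber wX) (Fiber wY) n → Fiber (λ (p : X × Y) → wX (proj₁ p) +ℕ wY (proj₂ p)) n
    from (i , j , e , (x , wx≡i) , (y , wy≡j)) = (x , y) , trans (cong₂ _+ℕ_ wx≡i wy≡j) e
    to∘from : ∀ y → to (from y) ≡ y
    to∘from (_ , _ , e , (x , refl) , (y , refl)) = refl

  Fiber-⊎ : ∀ n → Fiber [ wX , wY ] n ↔ (Fiber wX n ⊎ Fiber wY n)
  Fiber-⊎ n = mk↔ₛ′ to from to∘from from∘to
    where
    to : Fiber [ wX , wY ] n → Fiber wX n ⊎ Fiber wY n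
    to (inj₁ x , e) = inj₁ (x , e)
    to (inj₂ y , e) = inj₂ (y , e)
    from : Fiber wX n ⊎ Fiber wY n → Fiber [ wX , wY ] n
    from (inj₁ (x , e)) = inj₁ x , e
    from (inj₂ (y , e)) = inj₂ y , e
    to∘from : ∀ y → to (from y) ≡ y
    to∘from (inj₁ _) = refl
    to∘from (inj₂ _) = refl
    from∘to : ∀ x → from (to x) ≡ x
    from∘to (inj₁ _ , _) = refl
    from∘to (inj₂ _ , _) = refl

Counts-× : ∀ {X Y : Set} {wX : X → ℕ} {wY : Y → ℕ} {f g} → Counts f (Fiber wX) → Counts g (Fiber wY) →
           Counts (convolve f g) (Fiber (λ (p : X × Y) → wX (proj₁ p) +ℕ wY (proj₂ p)))
Counts-× {wX = wX} {wY} cX cY n = ↔-trans (Counts-convolve cX cY n) (↔-sym (Fiber-× wX wY n))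

Counts-⊎ : ∀ {X Y : Set} {wX : X → ℕ} {wY : Y → ℕ} {f g} → Counts f (Fiber wX) → Counts g (Fiber wY) →
           Counts (λ n → f n +ℕ g n) (Fiber [ wX , wY ])
Counts-⊎ {wX = wX} {wY} cX cY n = ↔-trans +↔⊎ (↔-trans (cX n ⊎-↔ cY n) (↔-sym (Fiber-⊎ wX wY n)))

-- Counting entries and vectors

monoCount : ℕ → ℕ → ℕ
monoCount zero zero = 1
monoCount zero (suc n) = 0
monoCount (suc k) zero = 0
monoCount (suc k) (suc n) = monoCount k n

Fin0↔ : ∀ {A : Set} → (A → ⊥) → Fin 0 ↔ A
Fin0↔ ¬A = mk↔ₛ′ (λ ()) (λ a → ⊥-elim (¬A a)) (λ a → ⊥-elim (¬A a)) (λ ())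

Counts-point : ∀ k → Counts (monoCount k) (Fiber (λ (_ : ⊤) → k))
Counts-point k n = ↔-trans (Fin-monoCount k n) (mk↔ₛ′ (tt ,_) proj₂ (λ _ → refl) (λ _ → refl))
  where
  Fin-monoCount : ∀ k n → Fin (monoCount k n) ↔ (k ≡ n)
  Fin-monoCount zero zero = mk↔ₛ′ (λ _ → refl) (λ _ → Fin.zero) (λ _ → ℕ.≡-irrelevant _ _) λ { Fin.zero → refl ; (Fin.suc ()) }
  Fin-monoCount zero (suc n) = Fin0↔ λ ()
  Fin-monoCount (suc k) zero = Fin0↔ λ ()
  Fin-monoCount (suc k) (suc n) = ↔-trans (Fin-monoCount k n) (≡-↔ (cong suc) ℕ.suc-injective)

geomCount : ℕ → ℕ → ℕ
geomCount s n = if ⌊ odd s ∣? n ⌋ then 1 else 0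

Counts-multiples : ∀ s → Counts (geomCount s) (Fiber (λ m → m *ℕ odd s))
Counts-multiples s n = by-cases (odd s ∣? n)
  where
  by-cases : (d : Dec (odd s ∣ n)) → Fin (if ⌊ d ⌋ then 1 else 0) ↔ Fiber (λ m → m *ℕ odd s) n
  by-cases (yes (divides q n≡q*o)) = mk↔ₛ′ (λ _ → q , sym n≡q*o) (λ _ → Fin.zero) unique λ { Fin.zero → refl ; (Fin.suc ()) }
    where
    unique : ∀ y → (q , sym n≡q*o) ≡ y
    unique (m , m*o≡n) with ℕ.*-cancelʳ-≡ q m (odd s) {{ℕ.>-nonZero (0<odd s)}} (trans (sym n≡q*o) (sym m*o≡n))
    ... | refl = cong (m ,_) (ℕ.≡-irrelevant _ _)
  by-cases (no ∤n) = Fin0↔ λ (m , m*o≡n) → ∤n (divides m (sym m*o≡n))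

entryWeight : ℕ → Entry → ℕ
entryWeight s (m , b) = (m +ℕ bit b) *ℕ odd s

entryCount : ℕ → ℕ → ℕ
entryCount s = convolve (λ n → monoCount 0 n +ℕ monoCount (odd s) n) (geomCount s)

Counts-entry : ∀ s → Counts (entryCount s) (Fiber (entryWeight s))
Counts-entry s = Counts-↔ (Counts-× overline (Counts-multiples s))
  (Fiber-↔ (×-comm Bool ℕ) (λ (b , m) → trans (ℕ.*-distribʳ-+ (odd s) m (bit b)) (ℕ.+-comm (m *ℕ odd s) _)))
  where
  ⊤⊎⊤↔Bool : (⊤ ⊎ ⊤) ↔ Bool
  ⊤⊎⊤↔Bool = mk↔ₛ′ [ (λ _ → false) , (λ _ → true) ] (λ { false → inj₁ tt ; true → inj₂ tt })
    (λ { false → refl ; true → refl }) (λ { (inj₁ tt) → refl ; (inj₂ tt) → refl })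
  overline : Counts (λ n → monoCount 0 n +ℕ monoCount (odd s) n) (Fiber (λ b → bit b *ℕ odd s))
  overline = Counts-↔ (Counts-⊎ (Counts-point 0) (Counts-point (odd s)))
    (Fiber-↔ ⊤⊎⊤↔Bool (λ { (inj₁ tt) → refl ; (inj₂ tt) → ℕ.+-identityʳ (odd s) }))

vecCount : ℕ → ℕ → ℕ → ℕ
vecCount s zero = monoCount 0
vecCount s (suc L) = convolve (entryCount s) (vecCount (suc s) L)

Counts-vec : ∀ s L → Counts (vecCount s L) (Fiber (weightFrom {L} s))
Counts-vec s zero = Counts-↔ (Counts-point 0) (Fiber-↔ nil↔ (λ _ → refl))
  where
  nil↔ : ⊤ ↔ Vec Entry 0
  nil↔ = mk↔ₛ′ (λ _ → []) (λ _ → tt) (λ { [] → refl }) (λ _ → refl)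
Counts-vec s (suc L) = Counts-↔ (Counts-× (Counts-entry s) (Counts-vec (suc s) L)) (Fiber-↔ cons↔ (λ _ → refl))
  where
  cons↔ : (Entry × Vec Entry L) ↔ Vec Entry (suc L)
  cons↔ = mk↔ₛ′ (λ (e , v) → e ∷ v) (λ { (e ∷ v) → e , v }) (λ { (e ∷ v) → refl }) (λ (e , v) → refl)

leadCount : ℕ → ℕ → ℕ → ℕ
leadCount a s = convolve (monoCount a) (geomCount s)

Counts-lead : ∀ a s {w : ℕ → ℕ} → (∀ m → w m ≡ a +ℕ m *ℕ odd s) → Counts (leadCount a s) (Fiber w)
Counts-lead a s w≡ = Counts-↔ (Counts-× (Counts-point a) (Counts-multiples s))
  (Fiber-↔ (mk↔ₛ′ proj₂ (tt ,_) (λ _ → refl) (λ _ → refl)) (λ (_ , m) → w≡ m))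

valid : ∀ {k} → Vec Entry k → Bool
valid [] = false
valid ((zero , _) ∷ _) = false
valid ((suc _ , false) ∷ _) = true
valid ((suc _ , true) ∷ v) = valid v

allBelow-suc : ∀ N p → allBelow (suc N) p ≡ p 0 ∧ allBelow N (p ∘ suc)
allBelow-suc zero p = sym (∧-identityʳ (p 0))
allBelow-suc (suc N) p = trans (cong (_∧ p (suc N)) (allBelow-suc N p)) (∧-assoc (p 0) _ _)

omoCond≡valid : ∀ {k} (v : Vec Entry k) → omoCond v ≡ valid v
omoCond≡valid [] = refl
omoCond≡valid ((zero , true) ∷ v) = allBelow-suc (suc (omoexIdx v)) _
omoCond≡valid ((suc m , true) ∷ v) = trans (allBelow-suc (suc (omoexIdx v)) _) (omoCond≡valid v)
omoCond≡valid ((zero , false) ∷ v) = refl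
omoCond≡valid ((suc m , false) ∷ v) = refl

ValidVec : ℕ → Set
ValidVec L = Σ (Vec Entry L) (T ∘ valid)

validCount : ℕ → ℕ → ℕ → ℕ
validCount s zero n = 0
validCount s (suc L) n =
  convolve (leadCount (odd s) s) (vecCount (suc s) L) n +ℕ convolve (leadCount (odd s +ℕ odd s) s) (validCount (suc s) L) n

Counts-valid : ∀ s L → Counts (validCount s L) (Fiber (λ (v : ValidVec L) → weightFrom s (proj₁ v)))
Counts-valid s zero n = Fin0↔ λ { (([] , ()) , _) }
Counts-valid s (suc L) = Counts-↔
  (Counts-⊎ (Counts-× (Counts-lead (odd s) s (λ m → closed m (odd s))) (Counts-vec (suc s) L))
            (Counts-× (Counts-lead (odd s +ℕ odd s) s (λ m → overlined m (odd s))) (Counts-valid (suc s) L)))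
  (Fiber-↔ head↔ λ { (inj₁ _) → refl ; (inj₂ _) → refl })
  where
  closed : ∀ m o → (suc m +ℕ 0) *ℕ o ≡ o +ℕ m *ℕ o
  closed = ℕ-Solver.solve-∀
  overlined : ∀ m o → (suc m +ℕ 1) *ℕ o ≡ (o +ℕ o) +ℕ m *ℕ o
  overlined = ℕ-Solver.solve-∀
  to : (ℕ × Vec Entry L) ⊎ (ℕ × ValidVec L) → ValidVec (suc L)
  to (inj₁ (m , v)) = (suc m , false) ∷ v , tt
  to (inj₂ (m , (v , valid-v))) = (suc m , true) ∷ v , valid-v
  from : ValidVec (suc L) → (ℕ × Vec Entry L) ⊎ (ℕ × ValidVec L)
  from ((suc m , false) ∷ v , _) = inj₁ (m , v)
  from ((suc m , true) ∷ v , valid-v) = inj₂ (m , (v , valid-v))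
  head↔ : ((ℕ × Vec Entry L) ⊎ (ℕ × ValidVec L)) ↔ ValidVec (suc L)
  head↔ = mk↔ₛ′ to from
    (λ { ((suc m , false) ∷ v , _) → refl ; ((suc m , true) ∷ v , _) → refl })
    (λ { (inj₁ _) → refl ; (inj₂ _) → refl })

MoTilde↔ValidVec : ∀ n → MoTilde n ↔ Fiber (λ (v : ValidVec n) → weightFrom 0 (proj₁ v)) n
MoTilde↔ValidVec n = mk↔ₛ′
  (λ ((v , w≡n) , cond) → (v , subst T (omoCond≡valid v) cond) , w≡n)
  (λ ((v , valid-v) , w≡n) → (v , w≡n) , subst T (sym (omoCond≡valid v)) valid-v)
  (λ ((v , _) , w≡n) → cong (λ t → (v , t) , w≡n) (T-irrelevant (valid v)))
  (λ ((v , w≡n) , _) → cong ((v , w≡n) ,_) (T-irrelevant (omoCond v)))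
  where
  T-irrelevant : ∀ b {x y : T b} → x ≡ y
  T-irrelevant true = refl

toSeries : (ℕ → ℕ) → Series
toSeries f n = + f n

toSeries-convolve : ∀ f g → toSeries (convolve f g) ≈ toSeries f ⊗ toSeries g
toSeries-convolve f g zero = trans (ℤ.pos-* (f 0) (g 0)) (sym (⊗-zero (toSeries f) (toSeries g)))
toSeries-convolve f g (suc n) =
  trans (cong₂ _+_ (ℤ.pos-* (f 0) (g (suc n))) (toSeries-convolve (f ∘ suc) g n)) (sym (⊗-suc (toSeries f) (toSeries g) n))

toSeries-monoCount : ∀ k → toSeries (monoCount k) ≈ mono k
toSeries-monoCount zero zero = refl
toSeries-monoCount zero (suc n) = refl
toSeries-monoCount (suc k) zero = refl
toSeries-monoCount (suc k) (suc n) = toSeries-monoCount k n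

toSeries-geomCount : ∀ s → toSeries (geomCount s) ≈ geomOdd s
toSeries-geomCount s n with ⌊ odd s ∣? n ⌋
... | true = refl
... | false = refl

toSeries-entryCount : ∀ s → toSeries (entryCount s) ≈ PoBarFactor s
toSeries-entryCount s = ≈-trans (toSeries-convolve (λ n → monoCount 0 n +ℕ monoCount (odd s) n) (geomCount s))
  (⊗-cong (λ n → cong₂ _+_ (toSeries-monoCount 0 n) (toSeries-monoCount (odd s) n)) (toSeries-geomCount s))

toSeries-vecCount : ∀ s L → toSeries (vecCount s L) ≈ prodFrom PoBarFactor s L
toSeries-vecCount s zero = toSeries-monoCount 0
toSeries-vecCount s (suc L) = ≈-trans (toSeries-convolve (entryCount s) (vecCount (suc s) L))
  (⊗-cong (toSeries-entryCount s) (toSeries-vecCount (suc s) L))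

toSeries-leadCount : ∀ a s → toSeries (leadCount a s) ≈ mono a ⊗ geomOdd s
toSeries-leadCount a s = ≈-trans (toSeries-convolve (monoCount a) (geomCount s)) (⊗-cong (toSeries-monoCount a) (toSeries-geomCount s))

toSeries-validCount : ∀ s L → toSeries (validCount s L) ≈ omoSeries s L
toSeries-validCount s zero n = refl
toSeries-validCount s (suc L) n = trans (cong₂ _+_
    (trans (toSeries-convolve (leadCount (odd s) s) (vecCount (suc s) L) n)
           (⊗-cong (toSeries-leadCount (odd s) s) (toSeries-vecCount (suc s) L) n))
    (trans (toSeries-convolve (leadCount (odd s +ℕ odd s) s) (validCount (suc s) L) n)
           (⊗-cong (toSeries-leadCount (odd s +ℕ odd s) s) (toSeries-validCount (suc s) L) n)))
  (sym (omoSeries-suc s L n))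

theorem2p4 : (n : ℕ) → Σ ℕ (λ m → (Fin m ↔ MoTilde n) × (rhsSeries n ≡ + m))
theorem2p4 n = validCount 0 n n , ↔-trans (Counts-valid 0 n n) (↔-sym (MoTilde↔ValidVec n)) , rhs≡count n
  where
  rhs≡count : ∀ n → rhsSeries n ≡ + validCount 0 n n
  -- Neither side has a constant term: rhsSeries is a shift and the empty vector is not valid.
  rhs≡count zero = refl
  rhs≡count (suc n) = sym (trans (toSeries-validCount 0 (suc n) (suc n)) (omoSeries≡rhsSeries n))
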